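{- Let $G$ be a finite simple graph and let $S$ be a super dominating set of $G$. Then: (a) There is a super dominating set $S'$ of $G$ with $|S'|=|S|$, $\overline{S}\subseteq S'$ and $\overline{S'}\subseteq S$. Furthermore, there is a bijective function $f:\overline{S'}\to\overline{S}$ such that $f(a)=b$ holds if and only if $a$ super dominates $b$ with respect to the super dominating set $S$ and $b$ super dominates $a$ with respect to the super dominating set $S'$. (b) With $D=S\cap S'$ (for $S'$ as in (a)), $V(G)$ is partitioned as $V(G)=\overline{S}\,\dot\cup\,\overline{S'}\,\dot\cup\, D$, and $S=\overline{S'}\,\dot\cup\, D$, $S'=\overline{S}\,\dot\cup\, D$. (c) If $|S|=|V(G)|/2$, then $\overline{S}$ is a super dominating set of the same cardinality, and $\overline{S}=S'$ and $\overline{S'}=S$. Furthermore, each vertex in $S$ super dominates exactly one vertex in $\overline{S}$ and vice versa, i.e., the function $f$ from (a) is uniquely determined.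
   Context: All graphs are finite, simple, undirected. For a vertex $v$, $N(v)$ is its open neighbourhood. For $S\subseteq V(G)$, $\overline{S}=V(G)\setminus S$. A set $S\subseteq V(G)$ is a dominating set if every vertex of $\overline{S}$ has a neighbour in $S$. A dominating set $S$ is a super dominating set if for every $u\in\overline{S}$ there is $v\in S$ with $N(v)\cap\overline{S}=\{u\}$; in that case we say $v$ super dominates $u$ (with respect to $S$). -}

module Defs where

open import Data.Nat using (ℕ; _*_)
open import Data.Bool using (Bool; true; false)
open import Data.Fin using (Fin)
open import Data.Fin.Subset using (Subset; _∈_; ∁; _∩_; _∪_; _⊆_; ∣_∣; ⁅_⁆)
  renaming (⊥ to ∅; ⊤ to Full)
open import Data.Vec using (tabulate)
open import Data.Product using (Σ; ∃; _×_; proj₁)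
open import Function.Bundles using (_⤖_; _⇔_; Bijection)
open import Relation.Binary.PropositionalEquality using (_≡_)

record Graph (n : ℕ) : Set where
  field
    adj   : Fin n → Fin n → Bool
    sym   : ∀ u v → adj u v ≡ adj v u
    irref : ∀ v → adj v v ≡ false

open Graph public

module _ {n : ℕ} (G : Graph n) where

  N : Fin n → Subset n
  N v = tabulate (adj G v)

  IsDominating : Subset n → Set
  IsDominating S = ∀ u → u ∈ ∁ S → ∃ λ v → v ∈ S × adj G u v ≡ true

  SuperDominates : Subset n → Fin n → Fin n → Set
  SuperDominates S v u = v ∈ S × u ∈ ∁ S × (N v ∩ ∁ S ≡ ⁅ u ⁆)

  IsSuperDominating : Subset n → Set
  IsSuperDominating S =
    IsDominating S × (∀ u → u ∈ ∁ S → ∃ λ v → SuperDominates S v u)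

  Compl : Subset n → Set
  Compl S = Σ (Fin n) (λ v → v ∈ ∁ S)

  MatchingProp : (S S' : Subset n) → (Compl S' → Compl S) → Set
  MatchingProp S S' f = ∀ (a : Compl S') (b : Compl S) →
    (proj₁ (f a) ≡ proj₁ b) ⇔
    (SuperDominates S (proj₁ a) (proj₁ b) × SuperDominates S' (proj₁ b) (proj₁ a))

  SuperDominatesExactlyOne : Subset n → Fin n → Set
  SuperDominatesExactlyOne S v =
    ∃ λ u → SuperDominates S v u × (∀ w → SuperDominates S v w → w ≡ u)

  PartA : (S S' : Subset n) → (f : Compl S' ⤖ Compl S) → Set
  PartA S S' f =
    IsSuperDominating S' × ∣ S' ∣ ≡ ∣ S ∣ × ∁ S ⊆ S' × ∁ S' ⊆ S ×
    MatchingProp S S' (Bijection.to f)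

  PartB : (S S' : Subset n) → Set
  PartB S S' =
    let D = S ∩ S' in
    (∁ S ∩ ∁ S' ≡ ∅) × (∁ S ∩ D ≡ ∅) × (∁ S' ∩ D ≡ ∅) ×
    (∁ S ∪ ∁ S' ∪ D ≡ Full) ×
    (S ≡ ∁ S' ∪ D) × (S' ≡ ∁ S ∪ D)

  PartC : (S S' : Subset n) → (f : Compl S' ⤖ Compl S) → Set
  PartC S S' f =
    2 * ∣ S ∣ ≡ n →
      IsSuperDominating (∁ S) × ∣ ∁ S ∣ ≡ ∣ S ∣ ×
      ∁ S ≡ S' × ∁ S' ≡ S ×
      (∀ v → v ∈ S → SuperDominatesExactlyOne S v) ×
      (∀ u → u ∈ ∁ S → SuperDominatesExactlyOne (∁ S) u) ×
      (∀ (g : Compl S' → Compl S) → MatchingProp S S' g →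
         ∀ a → proj₁ (g a) ≡ proj₁ (Bijection.to f a))

-- For every u ∉ S pick a vertex v(u) ∈ S super dominating u.  A vertex super
-- dominates at most one vertex, so v is injective; let T be its image and
-- S' = V ∖ T, i.e. exchange the roles of T and S̄.  Every u ∉ S then super
-- dominates v(u) with respect to S': a neighbour v(w) ∈ T of u has w as its only
-- neighbour outside S, so w = u.  Hence v⁻¹ : S̄' → S̄ is the required bijection.
-- If |S| = n/2, then |T| = |S̄| = |S| and T ⊆ S force T = S, i.e. S' = S̄.
module Submission where

open import Data.Bool using (Bool; true; false)
open import Data.Fin using (Fin; zero; suc)
open import Data.Fin.Properties using (_≟_; any?; 0≢1+n)
  renaming (suc-injective to Fin-suc-injective)
open import Data.Fin.Subset
open import Data.Fin.Subset.Properties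
open import Data.Nat using (ℕ; _≤_; _+_; _*_; _∸_; z≤n)
open import Data.Nat.Properties
  using (≤-antisym; ≤-reflexive; <⇒≱; m+n∸m≡n; +-identityʳ; module ≤-Reasoning)
open import Data.Product using (Σ; ∃; _×_; _,_; proj₁; proj₂; map₂; uncurry)
open import Data.Sum using (inj₁; inj₂; [_,_]′)
open import Data.Vec using ([]; _∷_; tabulate; here; there)
open import Data.Vec.Properties using (lookup∘tabulate; []=⇒lookup; lookup⇒[]=)
open import Data.Vec.Properties.WithK using ([]=-irrelevant)
open import Function using (_∘_)
open import Function.Bundles
  using (_↣_; _↔_; _⤖_; Injection; Bijection; Equivalence; mk↣; mk↔ₛ′; mk⇔)
open import Function.Construct.Composition using (_↣-∘_; _↔-∘_)
open import Function.Definitions using (Injective)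
open import Function.Properties.Inverse using (↔-sym; ↔⇒↣; ↔⇒⤖)
open import Relation.Nullary using (Dec; yes; no; does; contradiction)
open import Relation.Nullary.Decidable using (dec-true; map′)
open import Relation.Binary.PropositionalEquality
import Algebra.Lattice.Properties.BooleanAlgebra as BooleanAlgebraProperties

open import Defs hiding (sym)

Elem : ∀ {n} → Subset n → Set
Elem {n} p = Σ (Fin n) (_∈ p)

module _ {n : ℕ} where

  Elem-≡ : ∀ {p : Subset n} {a b : Elem p} → proj₁ a ≡ proj₁ b → a ≡ b
  Elem-≡ {a = x , x∈p} {.x , x∈p′} refl = cong (x ,_) ([]=-irrelevant x∈p x∈p′)

  ∈-tabulate⁺ : ∀ {f : Fin n → Bool} {x} → f x ≡ true → x ∈ tabulate f
  ∈-tabulate⁺ {f} {x} fx = lookup⇒[]= x (tabulate f) (trans (lookup∘tabulate f x) fx)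

  ∈-tabulate⁻ : ∀ {f : Fin n → Bool} {x} → x ∈ tabulate f → f x ≡ true
  ∈-tabulate⁻ {f} {x} x∈ = trans (sym (lookup∘tabulate f x)) ([]=⇒lookup x∈)

  ∁-involutive : ∀ (p : Subset n) → ∁ (∁ p) ≡ p
  ∁-involutive = BooleanAlgebraProperties.¬-involutive (∪-∩-booleanAlgebra n)

  ∈∁∁⁺ : ∀ {p : Subset n} {x} → x ∈ p → x ∈ ∁ (∁ p)
  ∈∁∁⁺ = x∉p⇒x∈∁p ∘ x∈p⇒x∉∁p

  ∈∁∁⁻ : ∀ {p : Subset n} {x} → x ∈ ∁ (∁ p) → x ∈ p
  ∈∁∁⁻ = x∉∁p⇒x∈p ∘ x∈∁p⇒x∉p

  Elem-∁∁-↔ : ∀ {p : Subset n} → Elem (∁ (∁ p)) ↔ Elem p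
  Elem-∁∁-↔ = mk↔ₛ′ (map₂ ∈∁∁⁻) (map₂ ∈∁∁⁺) (λ _ → Elem-≡ refl) (λ _ → Elem-≡ refl)

  ∣∁p∣≡∣∁q∣⇒∣p∣≡∣q∣ : ∀ (p q : Subset n) → ∣ ∁ p ∣ ≡ ∣ ∁ q ∣ → ∣ p ∣ ≡ ∣ q ∣
  ∣∁p∣≡∣∁q∣⇒∣p∣≡∣q∣ p q eq = begin
    ∣ p ∣          ≡⟨ cong ∣_∣ (∁-involutive p) ⟨
    ∣ ∁ (∁ p) ∣    ≡⟨ ∣∁p∣≡n∸∣p∣ (∁ p) ⟩
    n ∸ ∣ ∁ p ∣    ≡⟨ cong (n ∸_) eq ⟩
    n ∸ ∣ ∁ q ∣    ≡⟨ ∣∁p∣≡n∸∣p∣ (∁ q) ⟨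
    ∣ ∁ (∁ q) ∣    ≡⟨ cong ∣_∣ (∁-involutive q) ⟩
    ∣ q ∣          ∎
    where open ≡-Reasoning

  2*∣p∣≡n⇒∣∁p∣≡∣p∣ : ∀ (p : Subset n) → 2 * ∣ p ∣ ≡ n → ∣ ∁ p ∣ ≡ ∣ p ∣
  2*∣p∣≡n⇒∣∁p∣≡∣p∣ p half = begin
    ∣ ∁ p ∣              ≡⟨ ∣∁p∣≡n∸∣p∣ p ⟩
    n ∸ ∣ p ∣            ≡⟨ cong (_∸ ∣ p ∣) half ⟨
    2 * ∣ p ∣ ∸ ∣ p ∣    ≡⟨ m+n∸m≡n ∣ p ∣ _ ⟩
    ∣ p ∣ + 0            ≡⟨ +-identityʳ ∣ p ∣ ⟩
    ∣ p ∣                ∎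
    where open ≡-Reasoning

  p⊆q∧∣q∣≤∣p∣⇒p≡q : ∀ {p q : Subset n} → p ⊆ q → ∣ q ∣ ≤ ∣ p ∣ → p ≡ q
  p⊆q∧∣q∣≤∣p∣⇒p≡q {p} {q} p⊆q ∣q∣≤∣p∣ = ⊆-antisym p⊆q q⊆p
    where
    q⊆p : q ⊆ p
    q⊆p {x} x∈q with x ∈? p
    ... | yes x∈p = x∈p
    ... | no x∉p = contradiction ∣q∣≤∣p∣ (<⇒≱ (p⊂q⇒∣p∣<∣q∣ (p⊆q , x , x∈q , x∉p)))

  disjoint⇒∩≡⊥ : ∀ {p q : Subset n} → (∀ {x} → x ∈ p → x ∉ q) → p ∩ q ≡ ⊥
  disjoint⇒∩≡⊥ {p} {q} disjoint = Empty-unique λ (_ , x∈p∩q) → uncurry disjoint (x∈p∩q⁻ p q x∈p∩q)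

  ∁q⊆p⇒p≡∁q∪[p∩q] : ∀ {p q : Subset n} → ∁ q ⊆ p → p ≡ ∁ q ∪ (p ∩ q)
  ∁q⊆p⇒p≡∁q∪[p∩q] {p} {q} ∁q⊆p =
    ⊆-antisym split (λ x∈ → [ ∁q⊆p , proj₁ ∘ x∈p∩q⁻ p q ]′ (x∈p∪q⁻ (∁ q) (p ∩ q) x∈))
    where
    split : p ⊆ ∁ q ∪ (p ∩ q)
    split {x} x∈p with x ∈? q
    ... | yes x∈q = x∈p∪q⁺ (inj₂ (x∈p∩q⁺ (x∈p , x∈q)))
    ... | no x∉q = x∈p∪q⁺ (inj₁ (x∉p⇒x∈∁p x∉q))

there-↣ : ∀ {m s} {p : Subset m} → Elem p ↣ Elem (s ∷ p)
there-↣ = mk↣ {to = λ (x , x∈p) → suc x , there x∈p} (Elem-≡ ∘ Fin-suc-injective ∘ cong proj₁)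

↣-avoiding : ∀ {a n} {A : Set a} {q : Subset n} {y} (f : A ↣ Elem q) →
  (∀ x → proj₁ (Injection.to f x) ≢ y) → A ↣ Elem (q - y)
↣-avoiding f avoids = mk↣ {to = λ x → proj₁ (to x) , x∈p∧x≢y⇒x∈p-y (proj₂ (to x)) (avoids x)}
  (injective ∘ Elem-≡ ∘ cong proj₁)
  where open Injection f using (to; injective)

↣⇒∣p∣≤∣q∣ : ∀ {m n} {p : Subset m} {q : Subset n} → Elem p ↣ Elem q → ∣ p ∣ ≤ ∣ q ∣
↣⇒∣p∣≤∣q∣ {p = []} _ = z≤n
↣⇒∣p∣≤∣q∣ {p = false ∷ p} f = ↣⇒∣p∣≤∣q∣ (f ↣-∘ there-↣)
↣⇒∣p∣≤∣q∣ {p = true ∷ p} {q} f = begin-strict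
  ∣ p ∣       ≤⟨ ↣⇒∣p∣≤∣q∣ (↣-avoiding (f ↣-∘ there-↣) avoids) ⟩
  ∣ q - y ∣   <⟨ x∈p⇒∣p-x∣<∣p∣ (proj₂ (to (zero , here))) ⟩
  ∣ q ∣       ∎
  where
  open ≤-Reasoning
  open Injection f using (to; injective)
  y = proj₁ (to (zero , here))
  avoids : ∀ (a : Elem p) → proj₁ (to (suc (proj₁ a) , there (proj₂ a))) ≢ y
  avoids a eq = 0≢1+n (cong proj₁ (injective (Elem-≡ (sym eq))))

↔⇒∣p∣≡∣q∣ : ∀ {m n} {p : Subset m} {q : Subset n} → Elem p ↔ Elem q → ∣ p ∣ ≡ ∣ q ∣
↔⇒∣p∣≡∣q∣ p↔q = ≤-antisym (↣⇒∣p∣≤∣q∣ (↔⇒↣ p↔q)) (↣⇒∣p∣≤∣q∣ (↔⇒↣ (↔-sym p↔q)))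

module _ {m n : ℕ} {p : Subset m} (f : Elem p → Fin n) where

  private
    preimage? : ∀ y x → Dec (Σ (x ∈ p) λ x∈p → f (x , x∈p) ≡ y)
    preimage? y x with x ∈? p
    ... | no x∉p = no (x∉p ∘ proj₁)
    ... | yes x∈p =
      map′ (x∈p ,_) (λ (x∈p′ , eq) → trans (cong f (Elem-≡ refl)) eq) (f (x , x∈p) ≟ y)

    witness : ∀ {A : Set} (a? : Dec A) → does a? ≡ true → A
    witness (yes a) _ = a

  image : Subset n
  image = tabulate λ y → does (any? (preimage? y))

  ∈-image⁺ : ∀ a → f a ∈ image
  ∈-image⁺ (x , x∈p) = ∈-tabulate⁺ (dec-true (any? (preimage? _)) (x , x∈p , refl))

  preimage : ∀ {y} → y ∈ image → Elem p
  preimage y∈ with x , x∈p , _ ← witness (any? (preimage? _)) (∈-tabulate⁻ y∈) = x , x∈p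

  f∘preimage : ∀ {y} (y∈ : y ∈ image) → f (preimage y∈) ≡ y
  f∘preimage y∈ with _ , _ , eq ← witness (any? (preimage? _)) (∈-tabulate⁻ y∈) = eq

  image-↔ : Injective _≡_ _≡_ f → Elem p ↔ Elem image
  image-↔ f-injective = mk↔ₛ′ (λ a → f a , ∈-image⁺ a) (preimage ∘ proj₂)
    (λ (_ , y∈) → Elem-≡ (f∘preimage y∈))
    (λ a → f-injective (f∘preimage (∈-image⁺ a)))

module _ {n : ℕ} (G : Graph n) where

  adj-sym : ∀ {u v} → adj G u v ≡ true → adj G v u ≡ true
  adj-sym {u} {v} = trans (Graph.sym G v u)

  module _ {S : Subset n} where

    superDominates⇒adj : ∀ {v u} → SuperDominates G S v u → adj G v u ≡ true
    superDominates⇒adj {v} {u} (_ , _ , N∩∁S≡⁅u⁆) =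
      ∈-tabulate⁻ (proj₁ (x∈p∩q⁻ (N G v) (∁ S) (subst (u ∈_) (sym N∩∁S≡⁅u⁆) (x∈⁅x⁆ u))))

    superDominates⇒uniqueNeighbour : ∀ {v u w} → SuperDominates G S v u →
      adj G v w ≡ true → w ∈ ∁ S → w ≡ u
    superDominates⇒uniqueNeighbour {u = u} (_ , _ , N∩∁S≡⁅u⁆) vw w∉S =
      x∈⁅y⁆⇒x≡y u (subst (_ ∈_) N∩∁S≡⁅u⁆ (x∈p∩q⁺ (∈-tabulate⁺ vw , w∉S)))

    superDominates-unique : ∀ {v u w} → SuperDominates G S v u → SuperDominates G S v w → w ≡ u
    superDominates-unique v⊳u v⊳w@(_ , w∉S , _) =
      superDominates⇒uniqueNeighbour v⊳u (superDominates⇒adj v⊳w) w∉S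

    superDominates⇒exactlyOne : ∀ {v u} → SuperDominates G S v u → SuperDominatesExactlyOne G S v
    superDominates⇒exactlyOne {u = u} v⊳u = u , v⊳u , λ _ → superDominates-unique v⊳u

  superDominated⇒isSuperDominating : ∀ {S} → (∀ u → u ∈ ∁ S → ∃ λ v → SuperDominates G S v u) →
    IsSuperDominating G S
  superDominated⇒isSuperDominating superDominated = dominated , superDominated
    where
    dominated : IsDominating G _
    dominated u u∉S with v , v⊳u ← superDominated u u∉S =
      v , proj₁ v⊳u , adj-sym (superDominates⇒adj v⊳u)

  matching-unique : ∀ {S S'} (f g : Elem (∁ S') → Elem (∁ S)) →
    MatchingProp G S S' f → MatchingProp G S S' g → ∀ a → proj₁ (g a) ≡ proj₁ (f a)
  matching-unique f g f-matches g-matches a =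
    Equivalence.from (g-matches a (f a)) (Equivalence.to (f-matches a (f a)) refl)

  cover⇒PartB : ∀ {S S'} → ∁ S ⊆ S' → ∁ S' ⊆ S → PartB G S S'
  cover⇒PartB {S} {S'} ∁S⊆S' ∁S'⊆S =
    disjoint⇒∩≡⊥ (λ x∉S → x∈∁p⇒x∉p x∉S ∘ ∁S'⊆S) ,
    disjoint⇒∩≡⊥ (λ x∉S → x∈∁p⇒x∉p x∉S ∘ proj₁ ∘ x∈p∩q⁻ S S') ,
    disjoint⇒∩≡⊥ (λ x∉S' → x∈∁p⇒x∉p x∉S' ∘ proj₂ ∘ x∈p∩q⁻ S S') ,
    trans (cong (∁ S ∪_) (sym S≡)) (∪-inverseˡ S) ,
    S≡ ,
    trans (∁q⊆p⇒p≡∁q∪[p∩q] ∁S⊆S') (cong (∁ S ∪_) (∩-comm S' S))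
    where
    S≡ : S ≡ ∁ S' ∪ (S ∩ S')
    S≡ = ∁q⊆p⇒p≡∁q∪[p∩q] ∁S'⊆S

  module SwapRoles {S : Subset n} (dominator : Elem (∁ S) → Fin n)
                   (dominator-sd : ∀ u → SuperDominates G S (dominator u) (proj₁ u)) where

    dominator-injective : Injective _≡_ _≡_ dominator
    dominator-injective {u} {w} eq =
      Elem-≡ (superDominates-unique (dominator-sd w)
        (subst (λ v → SuperDominates G S v (proj₁ u)) eq (dominator-sd u)))

    Dominators : Subset n
    Dominators = image dominator

    S' : Subset n
    S' = ∁ Dominators

    dominates-preimage : ∀ {a} (a∈ : a ∈ Dominators) →
      SuperDominates G S a (proj₁ (preimage dominator a∈))
    dominates-preimage a∈ =
      subst (λ v → SuperDominates G S v (proj₁ u)) (f∘preimage dominator a∈) (dominator-sd u)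
      where u = preimage dominator a∈

    Dominators⊆S : Dominators ⊆ S
    Dominators⊆S = proj₁ ∘ dominates-preimage

    ∁S⊆S' : ∁ S ⊆ S'
    ∁S⊆S' x∉S = x∉p⇒x∈∁p (x∈∁p⇒x∉p x∉S ∘ Dominators⊆S)

    ∁S'⊆S : ∁ S' ⊆ S
    ∁S'⊆S = Dominators⊆S ∘ ∈∁∁⁻

    swap-superDominates : ∀ u → SuperDominates G S' (proj₁ u) (dominator u)
    swap-superDominates u@(b , b∉S) =
      ∁S⊆S' b∉S , ∈∁∁⁺ (∈-image⁺ dominator u) , ⊆-antisym onlyDominator dominator∈
      where
      onlyDominator : N G b ∩ ∁ S' ⊆ ⁅ dominator u ⁆
      onlyDominator x∈ with x∈N , x∉S' ← x∈p∩q⁻ (N G b) (∁ S') x∈ =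
        let x∈D = ∈∁∁⁻ x∉S'
            b≡preimage = superDominates⇒uniqueNeighbour (dominates-preimage x∈D)
                           (adj-sym (∈-tabulate⁻ x∈N)) b∉S
        in subst (_∈ ⁅ dominator u ⁆)
             (trans (cong dominator (Elem-≡ b≡preimage)) (f∘preimage dominator x∈D)) (x∈⁅x⁆ _)
      dominator∈ : ⁅ dominator u ⁆ ⊆ N G b ∩ ∁ S'
      dominator∈ x∈ with refl ← x∈⁅y⁆⇒x≡y _ x∈ =
        x∈p∩q⁺ (∈-tabulate⁺ (adj-sym (superDominates⇒adj (dominator-sd u))) ,
                ∈∁∁⁺ (∈-image⁺ dominator u))

    preimage-swap : ∀ {a} (a∈ : a ∈ Dominators) →
      SuperDominates G S' (proj₁ (preimage dominator a∈)) a
    preimage-swap a∈ =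
      subst (SuperDominates G S' _) (f∘preimage dominator a∈) (swap-superDominates _)

    S'-superDominating : IsSuperDominating G S'
    S'-superDominating = superDominated⇒isSuperDominating λ _ a∉S' → _ , preimage-swap (∈∁∁⁻ a∉S')

    ∁S'↔∁S : Elem (∁ S') ↔ Elem (∁ S)
    ∁S'↔∁S = ↔-sym (image-↔ dominator dominator-injective) ↔-∘ Elem-∁∁-↔

    matching : Elem (∁ S') ⤖ Elem (∁ S)
    matching = ↔⇒⤖ ∁S'↔∁S

    ∣S'∣≡∣S∣ : ∣ S' ∣ ≡ ∣ S ∣
    ∣S'∣≡∣S∣ = ∣∁p∣≡∣∁q∣⇒∣p∣≡∣q∣ S' S (↔⇒∣p∣≡∣q∣ ∁S'↔∁S)

    matching-prop : MatchingProp G S S' (Bijection.to matching)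
    matching-prop (a , a∉S') (b , _) = mk⇔
      (λ u≡b → subst (λ b → SuperDominates G S a b × SuperDominates G S' b a) u≡b
                 (dominates-preimage a∈ , preimage-swap a∈))
      (λ (a⊳b , _) → superDominates-unique a⊳b (dominates-preimage a∈))
      where a∈ = ∈∁∁⁻ a∉S'

    halfSize⇒PartC : PartC G S S' matching
    halfSize⇒PartC half =
      subst (IsSuperDominating G) (sym ∁S≡S') S'-superDominating ,
      ∣∁S∣≡∣S∣ ,
      ∁S≡S' ,
      trans (∁-involutive Dominators) Dominators≡S ,
      (λ v v∈S → superDominates⇒exactlyOne
                   (dominates-preimage (subst (v ∈_) (sym Dominators≡S) v∈S))) ,
      (λ u u∉S → superDominates⇒exactlyOne
                   (subst (λ X → SuperDominates G X u _) (sym ∁S≡S') (swap-superDominates (u , u∉S)))) ,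
      (λ g → matching-unique (Bijection.to matching) g matching-prop)
      where
      ∣∁S∣≡∣S∣ = 2*∣p∣≡n⇒∣∁p∣≡∣p∣ S half
      Dominators≡S : Dominators ≡ S
      Dominators≡S = p⊆q∧∣q∣≤∣p∣⇒p≡q Dominators⊆S
        (≤-reflexive (trans (sym ∣∁S∣≡∣S∣) (↔⇒∣p∣≡∣q∣ (image-↔ dominator dominator-injective))))
      ∁S≡S' : ∁ S ≡ S'
      ∁S≡S' = cong ∁ (sym Dominators≡S)

lemma2p1 : ∀ {n : ℕ} (G : Graph n) (S : Subset n) → IsSuperDominating G S →
    ∃ λ (S' : Subset n) → Σ (Compl G S' ⤖ Compl G S) λ f →
    PartA G S S' f × PartB G S S' × PartC G S S' f
lemma2p1 G S (_ , superDominated) =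
  S' , matching ,
  (S'-superDominating , ∣S'∣≡∣S∣ , ∁S⊆S' , ∁S'⊆S , matching-prop) ,
  cover⇒PartB G ∁S⊆S' ∁S'⊆S ,
  halfSize⇒PartC
  where
  open SwapRoles G (λ (u , u∉S) → proj₁ (superDominated u u∉S))
                   (λ (u , u∉S) → proj₂ (superDominated u u∉S))
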